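{- Let $M=\{(x,y,z)\in\{0,1\}^3 : (x\vee\overline{y}\vee\overline{z})\wedge(\overline{x}\vee z)\}$. For every Horn relation $R$ that is not IHSB$-$, $M$ is expressible as an existentially quantified $\mathrm{CNF}_C(\{R\})$-formula, i.e., there is a $\mathrm{CNF}_C(\{R\})$-formula $\psi(x,y,z,w_1,\dots,w_k)$ with $M=\{(a,b,c):\exists w_1\cdots\exists w_k\,\psi(a,b,c,w_1,\dots,w_k)\}$.
   Context: A relation is a subset of $\{0,1\}^n$. A $\mathrm{CNF}_C(\{R\})$-formula is a finite conjunction of constraints $R(\xi_1,\dots,\xi_n)$ with each $\xi_j$ a variable or a constant $0,1$ (variables may repeat). $R$ is Horn if it is the solution set of a CNF with at most one positive literal per clause, and IHSB$-$ if it is the solution set of a Horn CNF in which every clause with more than 2 literals has only negative literals. -}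

module Defs where

open import Data.Bool using (Bool; true; false; not; _∧_; _∨_; T)
open import Data.Nat using (ℕ; suc; _+_; _≤_; _<_)
open import Data.Fin using (Fin)
open import Data.Vec using (Vec; []; _∷_; lookup; map)
open import Data.List using (List; []; _∷_; length)
open import Data.List.Relation.Unary.All using (All)
open import Data.List.Relation.Unary.Any using (Any)
open import Data.Product using (Σ; ∃; _×_)
open import Data.Sum using (_⊎_)
open import Function.Bundles using (_⇔_)

BoolRel : ℕ → Set₁
BoolRel n = Vec Bool n → Set

data Literal (n : ℕ) : Set where
  pos : Fin n → Literal n
  neg : Fin n → Literal n

Clause : ℕ → Set
Clause n = List (Literal n)

CNF : ℕ → Set
CNF n = List (Clause n)

litSat : ∀ {n} → Vec Bool n → Literal n → Set
litSat v (pos i) = T (lookup v i)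
litSat v (neg i) = T (not (lookup v i))

clauseSat : ∀ {n} → Vec Bool n → Clause n → Set
clauseSat v c = Any (litSat v) c

cnfSat : ∀ {n} → Vec Bool n → CNF n → Set
cnfSat v φ = All (clauseSat v) φ

Defines : ∀ {n} → CNF n → BoolRel n → Set
Defines φ R = ∀ v → R v ⇔ cnfSat v φ

isPos : ∀ {n} → Literal n → Bool
isPos (pos _) = true
isPos (neg _) = false

posCount : ∀ {n} → Clause n → ℕ
posCount [] = 0
posCount (l ∷ c) with isPos l
... | true  = suc (posCount c)
... | false = posCount c

HornClause : ∀ {n} → Clause n → Set
HornClause c = posCount c ≤ 1

IHSBmClause : ∀ {n} → Clause n → Set
IHSBmClause c = HornClause c × (2 < length c → posCount c ≤ 0)

IsHorn : ∀ {n} → BoolRel n → Set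
IsHorn {n} R = Σ (CNF n) λ φ → All HornClause φ × Defines φ R

IsIHSBm : ∀ {n} → BoolRel n → Set
IsIHSBm {n} R = Σ (CNF n) λ φ → All IHSBmClause φ × Defines φ R

-- CNF_C({R})-formulas over m variables: each constraint R(ξ₁,…,ξₙ)
-- has arguments that are variables or constants 0/1.

data Term (m : ℕ) : Set where
  var   : Fin m → Term m
  const : Bool → Term m

evalTerm : ∀ {m} → Vec Bool m → Term m → Bool
evalTerm v (var i)   = lookup v i
evalTerm v (const b) = b

CNFC : ℕ → ℕ → Set
CNFC n m = List (Vec (Term m) n)

satCNFC : ∀ {n m} → BoolRel n → Vec Bool m → CNFC n m → Set
satCNFC R v ψ = All (λ args → R (map (evalTerm v) args)) ψ

M : BoolRel 3
M (x ∷ y ∷ z ∷ []) = T ((x ∨ not y ∨ not z) ∧ (not x ∨ z))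

EQExpressible : ∀ {n} → BoolRel n → BoolRel 3 → Set
EQExpressible {n} R S =
  Σ ℕ λ k → Σ (CNFC n (3 + k)) λ ψ →
    ∀ a b c → S (a ∷ b ∷ c ∷ []) ⇔ (Σ (Vec Bool k) λ w → satCNFC R (a ∷ b ∷ c ∷ w) ψ)

-- A Horn relation R is closed under coordinatewise ∧, and if R is closed under
-- (x, y, z) ↦ x ∧ (y ∨ z) then it is IHSB-: a valid Horn clause ¬a₁ ∨ … ∨ ¬aₖ ∨ b is implied
-- by one of the valid IHSB- clauses ¬a₁ ∨ … ∨ ¬aₖ, b, ¬aᵢ ∨ b, since otherwise counterexamples
-- to all of them combine under x ∧ (y ∨ z) into a solution violating the clause.  So if R is
-- not IHSB- there are r₀, r₁, r₂ ∈ R with r₀ ∧ (r₁ ∨ r₂) ∉ R.  Identifying the coordinates of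
-- R according to the columns of (r₀, r₁, r₂) yields a ternary relation τ, defined by a single
-- R-constraint, that contains 111, 010, 001, 000 (the images of r₀, r₀ ∧ r₁, r₀ ∧ r₂,
-- r₀ ∧ r₁ ∧ r₂) but not 011.  Only the values of τ on 100, 101, 110 are unknown, and for each
-- of the eight possibilities M is expressed by an explicit τ-formula with one auxiliary
-- variable.
module Submission where

open import Defs
open import Data.Nat using (ℕ)
open import Relation.Nullary using (¬_)

open import Data.Bool using (Bool; true; false; not; _∧_; _∨_; T)
open import Data.Bool.Properties using (T-≡; T-∧; T-not-≡; ¬-not)
open import Data.Nat using (zero; suc; _<_; z≤n; s≤s)
open import Data.Nat.Properties using (≤⇒≯; ≤-reflexive; ≤-trans)
open import Data.Fin using (Fin) renaming (zero to fzero; suc to fsuc)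
open import Data.Vec using (Vec; []; _∷_; lookup; map; zipWith; tabulate; _++_)
open import Data.Vec.Properties using (lookup-map; lookup-zipWith; lookup∘tabulate; map-∘; map-cong)
open import Data.Vec.Relation.Binary.Pointwise.Extensional using (ext; Pointwise-≡⇒≡)
open import Data.List using (List; []; _∷_)
import Data.List as List
open import Data.List.Relation.Unary.All as All using (All; []; _∷_)
open import Data.List.Relation.Unary.All.Properties using (map⁺; map⁻)
open import Data.List.Relation.Unary.Any using (here; there; any?)
open import Data.List.Membership.Propositional using (_∈_; find; lose)
open import Data.List.Membership.Propositional.Properties using (∈-map⁺; ∈-map⁻)
open import Data.List.Relation.Binary.Subset.Propositional using (_⊆_)
open import Data.List.Relation.Binary.Subset.Propositional.Properties using (Any-resp-⊆)
open import Data.Product using (∃; _×_; _,_; map₂)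
open import Data.Sum using (_⊎_; inj₁; inj₂)
open import Data.Empty using (⊥-elim)
open import Data.Unit using (tt)
open import Function using (_∘_; id)
open import Function.Bundles using (_⇔_; mk⇔; Equivalence)
open import Relation.Nullary using (Dec; yes; no)
open import Relation.Nullary.Decidable
  using (map′; _×-dec_; _⊎-dec_; _→-dec_; ¬?; T?; decidable-stable; isYes; True; toWitness; fromWitness)
open import Relation.Unary using (Decidable)
open import Relation.Binary.PropositionalEquality using (_≡_; refl; sym; trans; cong; subst; module ≡-Reasoning)

open Equivalence using (to; from)

∃? : ∀ {n} {P : Vec Bool n → Set} → Decidable P → Dec (∃ P)
∃? {zero}      P? = map′ ([] ,_) (λ { ([] , p) → p }) (P? [])
∃? {suc n} {P} P? = map′ cons uncons (∃? (P? ∘ (false ∷_)) ⊎-dec ∃? (P? ∘ (true ∷_)))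
  where
    cons : ∃ (P ∘ (false ∷_)) ⊎ ∃ (P ∘ (true ∷_)) → ∃ P
    cons (inj₁ (v , p)) = false ∷ v , p
    cons (inj₂ (v , p)) = true ∷ v , p

    uncons : ∃ P → ∃ (P ∘ (false ∷_)) ⊎ ∃ (P ∘ (true ∷_))
    uncons (false ∷ v , p) = inj₁ (v , p)
    uncons (true ∷ v , p)  = inj₂ (v , p)

∀? : ∀ {n} {P : Vec Bool n → Set} → Decidable P → Dec (∀ v → P v)
∀? P? = map′ (λ ∄¬P v → decidable-stable (P? v) (λ ¬p → ∄¬P (v , ¬p)))
             (λ ∀P (v , ¬p) → ¬p (∀P v))
             (¬? (∃? (¬? ∘ P?)))

_⇔?_ : ∀ {A B : Set} → Dec A → Dec B → Dec (A ⇔ B)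
a? ⇔? b? = map′ (λ (f , g) → mk⇔ f g) (λ e → to e , from e) ((a? →-dec b?) ×-dec (b? →-dec a?))

litSat? : ∀ {n} (v : Vec Bool n) → Decidable (litSat v)
litSat? v (pos i) = T? (lookup v i)
litSat? v (neg i) = T? (not (lookup v i))

clauseSat? : ∀ {n} (v : Vec Bool n) → Decidable (clauseSat v)
clauseSat? v = any? (litSat? v)

cnfSat? : ∀ {n} (v : Vec Bool n) → Decidable (cnfSat v)
cnfSat? v = All.all? (clauseSat? v)

defined-decidable : ∀ {n} {φ : CNF n} {R : BoolRel n} → Defines φ R → Decidable R
defined-decidable {φ = φ} def v = map′ (from (def v)) (to (def v)) (cnfSat? v φ)

∧-Closed : ∀ {n} → BoolRel n → Set
∧-Closed R = ∀ {u v} → R u → R v → R (zipWith _∧_ u v)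

and-or : ∀ {n} → Vec Bool n → Vec Bool n → Vec Bool n → Vec Bool n
and-or u v w = zipWith _∧_ u (zipWith _∨_ v w)

and-or-Closed : ∀ {n} → BoolRel n → Set
and-or-Closed R = ∀ {u v w} → R u → R v → R w → R (and-or u v w)

lookup-zipWith-zipWith : ∀ {n} (f g : Bool → Bool → Bool) (u v w : Vec Bool n) i →
  lookup (zipWith f u (zipWith g v w)) i ≡ f (lookup u i) (g (lookup v i) (lookup w i))
lookup-zipWith-zipWith f g u v w i =
  trans (lookup-zipWith f i u _) (cong (f (lookup u i)) (lookup-zipWith g i v w))

∧∨-true : ∀ {x y z} → x ≡ true → y ≡ true ⊎ z ≡ true → x ∧ (y ∨ z) ≡ true
∧∨-true {y = true}  refl _            = refl
∧∨-true {y = false} refl (inj₂ refl) = refl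

∧∨-false : ∀ {x y z} → y ≡ false → z ≡ false → x ∧ (y ∨ z) ≡ false
∧∨-false {x = false} refl refl = refl
∧∨-false {x = true}  refl refl = refl

and-or-true : ∀ {n} (u v w : Vec Bool n) {i} → lookup u i ≡ true →
  lookup v i ≡ true ⊎ lookup w i ≡ true → lookup (and-or u v w) i ≡ true
and-or-true u v w {i} ui vwi = trans (lookup-zipWith-zipWith _∧_ _∨_ u v w i) (∧∨-true ui vwi)

and-or-false : ∀ {n} (u v w : Vec Bool n) {i} → lookup v i ≡ false → lookup w i ≡ false →
  lookup (and-or u v w) i ≡ false
and-or-false u v w {i} vi wi = trans (lookup-zipWith-zipWith _∧_ _∨_ u v w i) (∧∨-false vi wi)

posCount-pos : ∀ {n} {c : Clause n} {i} → pos i ∈ c → 0 < posCount c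
posCount-pos {c = pos _ ∷ _} _           = s≤s z≤n
posCount-pos {c = neg _ ∷ _} (there i∈c) = posCount-pos i∈c

horn-unique : ∀ {n} {c : Clause n} {i j} → HornClause c → pos i ∈ c → pos j ∈ c → i ≡ j
horn-unique {c = pos _ ∷ _} _       (here refl)  (here refl)  = refl
horn-unique {c = pos _ ∷ _} (s≤s h) (here refl)  (there j∈c) = ⊥-elim (≤⇒≯ h (posCount-pos j∈c))
horn-unique {c = pos _ ∷ _} (s≤s h) (there i∈c) _            = ⊥-elim (≤⇒≯ h (posCount-pos i∈c))
horn-unique {c = neg _ ∷ _} h       (there i∈c) (there j∈c) = horn-unique h i∈c j∈c

horn-violated : ∀ {n} {c : Clause n} {j v} → HornClause c → pos j ∈ c →
  (∀ {a} → neg a ∈ c → lookup v a ≡ true) → lookup v j ≡ false → ¬ clauseSat v c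
horn-violated {v = v} horn j∈c negs-true j-false sat with find sat
... | neg a , a∈c , ¬va = subst (T ∘ not) (negs-true a∈c) ¬va
... | pos i , i∈c , vi  = subst T (trans (cong (lookup v) (horn-unique horn i∈c j∈c)) j-false) vi

not-∧ˡ : ∀ {x y} → T (not x) → T (not (x ∧ y))
not-∧ˡ {false} _ = tt

not-∧ʳ : ∀ {x y} → T (not y) → T (not (x ∧ y))
not-∧ʳ {false}         _ = tt
not-∧ʳ {true} {false} _ = tt

hornClause-∧ : ∀ {n} {c : Clause n} {u v} → HornClause c →
  clauseSat u c → clauseSat v c → clauseSat (zipWith _∧_ u v) c
hornClause-∧ {u = u} {v} horn su sv with find su | find sv
... | neg a , a∈c , ¬ua | _ =
  lose a∈c (subst (T ∘ not) (sym (lookup-zipWith _∧_ a u v)) (not-∧ˡ ¬ua))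
... | pos _ , _ , _ | neg a , a∈c , ¬va =
  lose a∈c (subst (T ∘ not) (sym (lookup-zipWith _∧_ a u v)) (not-∧ʳ ¬va))
... | pos i , i∈c , ui | pos j , j∈c , vj =
  lose j∈c (subst T (sym (lookup-zipWith _∧_ j u v))
                    (from T-∧ (subst (T ∘ lookup u) (horn-unique horn i∈c j∈c) ui , vj)))

hornCNF-∧ : ∀ {n} {φ : CNF n} {u v} → All HornClause φ → cnfSat u φ → cnfSat v φ →
  cnfSat (zipWith _∧_ u v) φ
hornCNF-∧ []             []         []         = []
hornCNF-∧ (horn ∷ horns) (su ∷ sus) (sv ∷ svs) = hornClause-∧ horn su sv ∷ hornCNF-∧ horns sus svs

horn-∧-Closed : ∀ {n} {φ : CNF n} {R : BoolRel n} → All HornClause φ → Defines φ R → ∧-Closed R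
horn-∧-Closed horns def Ru Rv = from (def _) (hornCNF-∧ horns (to (def _) Ru) (to (def _) Rv))

negVars : ∀ {n} → Clause n → List (Fin n)
negVars []          = []
negVars (pos _ ∷ c) = negVars c
negVars (neg a ∷ c) = a ∷ negVars c

negatives : ∀ {n} → Clause n → Clause n
negatives c = List.map neg (negVars c)

neg∈⇒∈negVars : ∀ {n} {c : Clause n} {a} → neg a ∈ c → a ∈ negVars c
neg∈⇒∈negVars {c = pos _ ∷ _} (there a∈c) = neg∈⇒∈negVars a∈c
neg∈⇒∈negVars {c = neg _ ∷ _} (here refl) = here refl
neg∈⇒∈negVars {c = neg _ ∷ _} (there a∈c) = there (neg∈⇒∈negVars a∈c)

∈negVars⇒neg∈ : ∀ {n} {c : Clause n} {a} → a ∈ negVars c → neg a ∈ c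
∈negVars⇒neg∈ {c = pos _ ∷ _} a∈        = there (∈negVars⇒neg∈ a∈)
∈negVars⇒neg∈ {c = neg _ ∷ _} (here refl) = here refl
∈negVars⇒neg∈ {c = neg _ ∷ _} (there a∈) = there (∈negVars⇒neg∈ a∈)

negatives-⊆ : ∀ {n} {c : Clause n} → negatives c ⊆ c
negatives-⊆ l∈ with ∈-map⁻ neg l∈
... | _ , a∈ , refl = ∈negVars⇒neg∈ a∈

head-or-negatives : ∀ {n} (c : Clause n) → (∃ λ j → pos j ∈ c) ⊎ c ≡ negatives c
head-or-negatives []          = inj₂ refl
head-or-negatives (pos j ∷ c) = inj₁ (j , here refl)
head-or-negatives (neg a ∷ c) with head-or-negatives c
... | inj₁ (j , j∈c) = inj₁ (j , there j∈c)
... | inj₂ c≡negs    = inj₂ (cong (neg a ∷_) c≡negs)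

posCount-negatives : ∀ {n} (xs : List (Fin n)) → posCount (List.map neg xs) ≡ 0
posCount-negatives []       = refl
posCount-negatives (_ ∷ xs) = posCount-negatives xs

ihsb-negatives : ∀ {n} (xs : List (Fin n)) → IHSBmClause (List.map neg xs)
ihsb-negatives xs = ≤-trans none z≤n , λ _ → none
  where none = ≤-reflexive (posCount-negatives xs)

ihsb-unit : ∀ {n} (j : Fin n) → IHSBmClause (pos j ∷ [])
ihsb-unit _ = s≤s z≤n , λ { (s≤s ()) }

ihsb-binary : ∀ {n} (a j : Fin n) → IHSBmClause (neg a ∷ pos j ∷ [])
ihsb-binary _ _ = s≤s z≤n , λ { (s≤s (s≤s ())) }

unsat-neg : ∀ {n} {c : Clause n} {v a} → ¬ clauseSat v c → neg a ∈ c → lookup v a ≡ true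
unsat-neg ¬sat a∈c = ¬-not (¬sat ∘ lose a∈c ∘ from T-not-≡)

unsat-pos : ∀ {n} {c : Clause n} {v i} → ¬ clauseSat v c → pos i ∈ c → lookup v i ≡ false
unsat-pos ¬sat i∈c = ¬-not (¬sat ∘ lose i∈c ∘ from T-≡)

module AndOrClosed {n} {S : BoolRel n} (S? : Decidable S) (closed : and-or-Closed S) where

  Valid : Clause n → Set
  Valid c = ∀ v → S v → clauseSat v c

  valid? : Decidable Valid
  valid? c = ∀? λ v → S? v →-dec clauseSat? v c

  counterexample : ∀ {c} → ¬ Valid c → ∃ λ v → S v × ¬ clauseSat v c
  counterexample {c} ¬valid with ∃? (λ v → S? v ×-dec ¬? (clauseSat? v c))
  ... | yes cex  = cex
  ... | no ∄cex = ⊥-elim (¬valid λ v Sv → decidable-stable (clauseSat? v c) (λ ¬sat → ∄cex (v , Sv , ¬sat)))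

  Separating : Fin n → Fin n → Set
  Separating j a = ∃ λ r → S r × lookup r a ≡ true × lookup r j ≡ false

  separating-solution : ∀ {j r₀ h₀} {L : List (Fin n)} →
    S r₀ → All (λ a → lookup r₀ a ≡ true) L → S h₀ → lookup h₀ j ≡ false → All (Separating j) L →
    ∃ λ h → S h × All (λ a → lookup h a ≡ true) L × lookup h j ≡ false
  separating-solution _ _ Sh₀ h₀j [] = _ , Sh₀ , [] , h₀j
  separating-solution {r₀ = r₀} Sr₀ (r₀a ∷ r₀L) Sh₀ h₀j ((r , Sr , ra , rj) ∷ seps)
    with separating-solution Sr₀ r₀L Sh₀ h₀j seps
  ... | h , Sh , hL , hj =
    and-or r₀ r h , closed Sr₀ Sr Sh ,
    and-or-true r₀ r h r₀a (inj₁ ra) ∷ All.zipWith (λ (r₀b , hb) → and-or-true r₀ r h r₀b (inj₂ hb)) (r₀L , hL) ,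
    and-or-false r₀ r h rj hj

  separates : ∀ {a j} → ¬ Valid (neg a ∷ pos j ∷ []) → Separating j a
  separates ¬v with counterexample ¬v
  ... | r , Sr , ¬sat = r , Sr , unsat-neg ¬sat (here refl) , unsat-pos ¬sat (there (here refl))

  falsifying-solution : ∀ {c j} → ¬ Valid (negatives c) → ¬ Valid (pos j ∷ []) → All (Separating j) (negVars c) →
    ∃ λ h → S h × All (λ a → lookup h a ≡ true) (negVars c) × lookup h j ≡ false
  falsifying-solution ¬v₀ ¬v₁ seps with counterexample ¬v₀ | counterexample ¬v₁
  ... | r₀ , Sr₀ , ¬sat₀ | h₀ , Sh₀ , ¬sat₁ =
    separating-solution Sr₀ (All.tabulate (unsat-neg ¬sat₀ ∘ ∈-map⁺ neg)) Sh₀ (unsat-pos ¬sat₁ (here refl)) seps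

  strengthen-head : ∀ {c j} → HornClause c → Valid c → pos j ∈ c →
    ∃ λ c′ → IHSBmClause c′ × Valid c′ × c′ ⊆ c
  strengthen-head {c} {j} horn valid j∈c with valid? (negatives c)
  ... | yes v = negatives c , ihsb-negatives (negVars c) , v , negatives-⊆
  ... | no ¬v₀ with valid? (pos j ∷ [])
  ...   | yes v = pos j ∷ [] , ihsb-unit j , v , λ { (here refl) → j∈c }
  ...   | no ¬v₁ with All.search (λ a → valid? (neg a ∷ pos j ∷ [])) (negVars c)
  ...     | inj₂ some-valid =
    let a , a∈ , v = find some-valid in
    neg a ∷ pos j ∷ [] , ihsb-binary a j , v , λ { (here refl) → ∈negVars⇒neg∈ a∈ ; (there (here refl)) → j∈c }
  ...     | inj₁ none-valid with falsifying-solution {c} ¬v₀ ¬v₁ (All.map separates none-valid)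
  ...       | h , Sh , hL , hj =
    ⊥-elim (horn-violated horn j∈c (All.lookup hL ∘ neg∈⇒∈negVars) hj (valid h Sh))

  strengthen : ∀ {c} → HornClause c → Valid c → ∃ λ c′ → IHSBmClause c′ × Valid c′ × c′ ⊆ c
  strengthen {c} horn valid with head-or-negatives c
  ... | inj₁ (j , j∈c) = strengthen-head horn valid j∈c
  ... | inj₂ c≡negs    = c , subst IHSBmClause (sym c≡negs) (ihsb-negatives (negVars c)) , valid , id

  strengthen-cnf : ∀ {φ : CNF n} → All HornClause φ → All Valid φ →
    ∃ λ ψ → All IHSBmClause ψ × All Valid ψ × (∀ {v} → cnfSat v ψ → cnfSat v φ)
  strengthen-cnf [] [] = [] , [] , [] , λ _ → []
  strengthen-cnf (horn ∷ horns) (valid ∷ valids) with strengthen horn valid | strengthen-cnf horns valids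
  ... | c′ , ihsb , valid′ , c′⊆c | ψ , ihsbs , valids′ , ψ⇒φ =
    c′ ∷ ψ , ihsb ∷ ihsbs , valid′ ∷ valids′ , λ { (s ∷ ss) → Any-resp-⊆ c′⊆c s ∷ ψ⇒φ ss }

  isIHSBm : ∀ {φ : CNF n} → All HornClause φ → Defines φ S → IsIHSBm S
  isIHSBm horns def with strengthen-cnf horns (All.tabulate (λ c∈φ v Sv → All.lookup (to (def v) Sv) c∈φ))
  ... | ψ , ihsbs , valids , ψ⇒φ =
    ψ , ihsbs , λ v → mk⇔ (λ Sv → All.map (λ valid → valid v Sv) valids) (from (def v) ∘ ψ⇒φ)

and-or-closed-or-witness : ∀ {n} {R : BoolRel n} → Decidable R →
  and-or-Closed R ⊎ ∃ λ r₀ → ∃ λ r₁ → ∃ λ r₂ → R r₀ × R r₁ × R r₂ × ¬ R (and-or r₀ r₁ r₂)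
and-or-closed-or-witness R?
  with ∃? (λ u → ∃? λ v → ∃? λ w → R? u ×-dec R? v ×-dec R? w ×-dec ¬? (R? (and-or u v w)))
... | yes witness = inj₂ witness
... | no none     = inj₁ λ Ru Rv Rw → decidable-stable (R? _) λ ¬R → none (_ , _ , _ , Ru , Rv , Rw , ¬R)

substTerm : ∀ {k m} → Vec (Term m) k → Term k → Term m
substTerm σ (var i)   = lookup σ i
substTerm σ (const b) = const b

evalTerm-substTerm : ∀ {k m} (v : Vec Bool m) (σ : Vec (Term m) k) t →
  evalTerm v (substTerm σ t) ≡ evalTerm (map (evalTerm v) σ) t
evalTerm-substTerm v σ (var i)   = sym (lookup-map i (evalTerm v) σ)
evalTerm-substTerm v σ (const b) = refl

instantiate : ∀ {n k m} → Vec (Term k) n → CNFC k m → CNFC n m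
instantiate P = List.map λ σ → map (substTerm σ) P

evalTerm-instance : ∀ {n k m} (v : Vec Bool m) (σ : Vec (Term m) k) (P : Vec (Term k) n) →
  map (evalTerm v) (map (substTerm σ) P) ≡ map (evalTerm (map (evalTerm v) σ)) P
evalTerm-instance v σ P = trans (sym (map-∘ (evalTerm v) (substTerm σ) P)) (map-cong (evalTerm-substTerm v σ) P)

satCNFC-instantiate : ∀ {n k m} {R : BoolRel n} {S : BoolRel k} (P : Vec (Term k) n) →
  (∀ u → S u ⇔ R (map (evalTerm u) P)) → ∀ (v : Vec Bool m) ψ →
  satCNFC R v (instantiate P ψ) ⇔ satCNFC S v ψ
satCNFC-instantiate {R = R} P S⇔R v ψ = mk⇔
  (All.map (λ {σ} Rσ → from (S⇔R _) (subst R (evalTerm-instance v σ P) Rσ)) ∘ map⁻)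
  (map⁺ ∘ All.map (λ {σ} Sσ → subst R (sym (evalTerm-instance v σ P)) (to (S⇔R _) Sσ)))

EQExpressible-instantiate : ∀ {n k} {R : BoolRel n} {S : BoolRel k} {Q : BoolRel 3} (P : Vec (Term k) n) →
  (∀ u → S u ⇔ R (map (evalTerm u) P)) → EQExpressible S Q → EQExpressible R Q
EQExpressible-instantiate {R = R} P S⇔R (k , ψ , expr) = k , instantiate P ψ , λ a b c →
  let sat⇔ = λ w → satCNFC-instantiate {R = R} P S⇔R (a ∷ b ∷ c ∷ w) ψ in
  mk⇔ (map₂ (λ {w} → from (sat⇔ w)) ∘ to (expr a b c))
      (from (expr a b c) ∘ map₂ (λ {w} → to (sat⇔ w)))

ternary : Bool → Bool → Bool → Vec Bool 3 → Bool
ternary _  _  _  (false ∷ true  ∷ true  ∷ []) = false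
ternary e₁ _  _  (true  ∷ false ∷ false ∷ []) = e₁
ternary _  e₂ _  (true  ∷ false ∷ true  ∷ []) = e₂
ternary _  _  e₃ (true  ∷ true  ∷ false ∷ []) = e₃
ternary _  _  _  _                            = true

Ternary : Bool → Bool → Bool → BoolRel 3
Ternary e₁ e₂ e₃ v = T (ternary e₁ e₂ e₃ v)

M? : Decidable M
M? (x ∷ y ∷ z ∷ []) = T? _

satCNFC? : ∀ {k m} {S : BoolRel k} → Decidable S → ∀ (v : Vec Bool m) → Decidable (satCNFC S v)
satCNFC? S? v = All.all? (λ args → S? (map (evalTerm v) args))

expresses? : ∀ {S : BoolRel 3} → Decidable S → (ψ : CNFC 3 4) →
  Dec (∀ v → M v ⇔ ∃ λ w → satCNFC S (v ++ w) ψ)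
expresses? S? ψ = ∀? λ v → M? v ⇔? ∃? (λ w → satCNFC? S? (v ++ w) ψ)

by-gadget : ∀ {S : BoolRel 3} (S? : Decidable S) (ψ : CNFC 3 4) → True (expresses? S? ψ) → EQExpressible S M
by-gadget S? ψ check = 1 , ψ , λ a b c → toWitness check (a ∷ b ∷ c ∷ [])

X Y Z W : Term 4
X = var fzero
Y = var (fsuc fzero)
Z = var (fsuc (fsuc fzero))
W = var (fsuc (fsuc (fsuc fzero)))

gadget : ∀ e₁ e₂ e₃ → EQExpressible (Ternary e₁ e₂ e₃) M
gadget false false false = by-gadget (T? ∘ ternary _ _ _) ((X ∷ Z ∷ W ∷ []) ∷ (Y ∷ Y ∷ W ∷ []) ∷ []) tt
gadget false true  false = by-gadget (T? ∘ ternary _ _ _) ((X ∷ Y ∷ Z ∷ []) ∷ []) tt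
gadget false false true  = by-gadget (T? ∘ ternary _ _ _) ((X ∷ Z ∷ Y ∷ []) ∷ []) tt
gadget true  true  false = by-gadget (T? ∘ ternary _ _ _) ((X ∷ X ∷ Z ∷ []) ∷ (X ∷ Y ∷ Z ∷ []) ∷ []) tt
gadget false true  true  = by-gadget (T? ∘ ternary _ _ _) ((X ∷ Y ∷ Z ∷ []) ∷ (X ∷ Z ∷ const false ∷ []) ∷ []) tt
gadget true  true  true  = by-gadget (T? ∘ ternary _ _ _) ((X ∷ Y ∷ Z ∷ []) ∷ (Z ∷ X ∷ X ∷ []) ∷ []) tt
gadget true  false true  = by-gadget (T? ∘ ternary _ _ _) ((X ∷ Z ∷ X ∷ []) ∷ (X ∷ Z ∷ Y ∷ []) ∷ []) tt
gadget true  false false = by-gadget (T? ∘ ternary _ _ _) ((X ∷ X ∷ Z ∷ []) ∷ (X ∷ Y ∷ W ∷ []) ∷ (Y ∷ Z ∷ W ∷ []) ∷ []) tt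

columnPattern : Bool → Bool → Bool → Term 3
columnPattern false _     _     = const false
columnPattern true  false false = var fzero
columnPattern true  true  false = var (fsuc fzero)
columnPattern true  false true  = var (fsuc (fsuc fzero))
columnPattern true  true  true  = const true

columnPattern-111 : ∀ p q s → evalTerm (true ∷ true ∷ true ∷ []) (columnPattern p q s) ≡ p
columnPattern-111 false _     _     = refl
columnPattern-111 true  false false = refl
columnPattern-111 true  true  false = refl
columnPattern-111 true  false true  = refl
columnPattern-111 true  true  true  = refl

columnPattern-010 : ∀ p q s → evalTerm (false ∷ true ∷ false ∷ []) (columnPattern p q s) ≡ p ∧ q
columnPattern-010 false _     _     = refl
columnPattern-010 true  false false = refl
columnPattern-010 true  true  false = refl
columnPattern-010 true  false true  = refl
columnPattern-010 true  true  true  = refl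

columnPattern-001 : ∀ p q s → evalTerm (false ∷ false ∷ true ∷ []) (columnPattern p q s) ≡ p ∧ s
columnPattern-001 false _     _     = refl
columnPattern-001 true  false false = refl
columnPattern-001 true  true  false = refl
columnPattern-001 true  false true  = refl
columnPattern-001 true  true  true  = refl

columnPattern-000 : ∀ p q s → evalTerm (false ∷ false ∷ false ∷ []) (columnPattern p q s) ≡ p ∧ (q ∧ s)
columnPattern-000 false _     _     = refl
columnPattern-000 true  false false = refl
columnPattern-000 true  true  false = refl
columnPattern-000 true  false true  = refl
columnPattern-000 true  true  true  = refl

columnPattern-011 : ∀ p q s → evalTerm (false ∷ true ∷ true ∷ []) (columnPattern p q s) ≡ p ∧ (q ∨ s)
columnPattern-011 false _     _     = refl
columnPattern-011 true  false false = refl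
columnPattern-011 true  true  false = refl
columnPattern-011 true  false true  = refl
columnPattern-011 true  true  true  = refl

True⇔ : ∀ {A : Set} (a? : Dec A) → True a? ⇔ A
True⇔ a? = mk⇔ toWitness fromWitness

module NotAndOrClosed {n} {R : BoolRel n} (R? : Decidable R) (∧-closed : ∧-Closed R)
  {r₀ r₁ r₂ : Vec Bool n} (R₀ : R r₀) (R₁ : R r₁) (R₂ : R r₂) (¬R : ¬ R (and-or r₀ r₁ r₂)) where

  columns : Vec (Term 3) n
  columns = tabulate λ i → columnPattern (lookup r₀ i) (lookup r₁ i) (lookup r₂ i)

  point : Vec Bool 3 → Vec Bool n
  point u = map (evalTerm u) columns

  point-≡ : ∀ u {t} {g : Bool → Bool → Bool → Bool} → (∀ p q s → evalTerm u (columnPattern p q s) ≡ g p q s) →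
    (∀ i → g (lookup r₀ i) (lookup r₁ i) (lookup r₂ i) ≡ lookup t i) → point u ≡ t
  point-≡ u column-eq eq = Pointwise-≡⇒≡ (ext λ i → begin
    lookup (point u) i                                                   ≡⟨ lookup-map i (evalTerm u) columns ⟩
    evalTerm u (lookup columns i)                                        ≡⟨ cong (evalTerm u) (lookup∘tabulate _ i) ⟩
    evalTerm u (columnPattern (lookup r₀ i) (lookup r₁ i) (lookup r₂ i)) ≡⟨ column-eq _ _ _ ⟩
    _                                                                    ≡⟨ eq i ⟩
    _                                                                    ∎)
    where open ≡-Reasoning

  R-111 : R (point (true ∷ true ∷ true ∷ []))
  R-111 = subst R (sym (point-≡ _ columnPattern-111 λ _ → refl)) R₀

  R-010 : R (point (false ∷ true ∷ false ∷ []))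
  R-010 = subst R (sym (point-≡ _ columnPattern-010 λ i → sym (lookup-zipWith _∧_ i r₀ r₁))) (∧-closed R₀ R₁)

  R-001 : R (point (false ∷ false ∷ true ∷ []))
  R-001 = subst R (sym (point-≡ _ columnPattern-001 λ i → sym (lookup-zipWith _∧_ i r₀ r₂))) (∧-closed R₀ R₂)

  R-000 : R (point (false ∷ false ∷ false ∷ []))
  R-000 = subst R (sym (point-≡ _ columnPattern-000 λ i → sym (lookup-zipWith-zipWith _∧_ _∧_ r₀ r₁ r₂ i)))
                  (∧-closed R₀ (∧-closed R₁ R₂))

  ¬R-011 : ¬ R (point (false ∷ true ∷ true ∷ []))
  ¬R-011 = ¬R ∘ subst R (point-≡ _ columnPattern-011 λ i → sym (lookup-zipWith-zipWith _∧_ _∨_ r₀ r₁ r₂ i))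

  e₁ e₂ e₃ : Bool
  e₁ = isYes (R? (point (true ∷ false ∷ false ∷ [])))
  e₂ = isYes (R? (point (true ∷ false ∷ true ∷ [])))
  e₃ = isYes (R? (point (true ∷ true ∷ false ∷ [])))

  ternary-defined : ∀ u → Ternary e₁ e₂ e₃ u ⇔ R (point u)
  ternary-defined (false ∷ false ∷ false ∷ []) = mk⇔ (λ _ → R-000) (λ _ → tt)
  ternary-defined (false ∷ false ∷ true  ∷ []) = mk⇔ (λ _ → R-001) (λ _ → tt)
  ternary-defined (false ∷ true  ∷ false ∷ []) = mk⇔ (λ _ → R-010) (λ _ → tt)
  ternary-defined (false ∷ true  ∷ true  ∷ []) = mk⇔ (λ ()) ¬R-011
  ternary-defined (true  ∷ false ∷ false ∷ []) = True⇔ (R? _)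
  ternary-defined (true  ∷ false ∷ true  ∷ []) = True⇔ (R? _)
  ternary-defined (true  ∷ true  ∷ false ∷ []) = True⇔ (R? _)
  ternary-defined (true  ∷ true  ∷ true  ∷ []) = mk⇔ (λ _ → R-111) (λ _ → tt)

  expressible : EQExpressible R M
  expressible = EQExpressible-instantiate {R = R} {Q = M} columns ternary-defined (gadget e₁ e₂ e₃)

lemma3p35 : ∀ (n : ℕ) (R : BoolRel n) → IsHorn R → ¬ IsIHSBm R → EQExpressible R M
lemma3p35 n R (φ , horns , def) not-ihsb with defined-decidable def
... | R? with and-or-closed-or-witness R?
...   | inj₁ closed = ⊥-elim (not-ihsb (AndOrClosed.isIHSBm R? closed horns def))
...   | inj₂ (_ , _ , _ , R₀ , R₁ , R₂ , ¬R) =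
  NotAndOrClosed.expressible R? (horn-∧-Closed horns def) R₀ R₁ R₂ ¬R
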